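{- Let $M$ be a matroid of rank $r\geq 2$, and let $f$ and $g$ be distinct elements of $M$ such that $f$ is freer than $g$ in $M$. Then $W_{r-2}(f;M)=W_{r-2}(g;M)$ if and only if $f$ and $g$ are clones in the matroid obtained from $\tau(M)$ by deleting every element of $E(M)-\{f,g\}$ that is parallel to $g$ in $\tau(M)$.
   Context: For distinct elements $f,g$ of a matroid $M$, $f$ is freer than $g$ if $g$ is contained in the closure of every circuit of $M$ that contains $f$. $W_k(e;M)$ is the number of rank-$k$ flats of $M$ containing $e$. The truncation $\tau(M)$ is obtained from $M$ by taking the free extension of $M$ by a new element $e$ and then contracting $e$; when $r(M)>0$, the independent sets of $\tau(M)$ are exactly the independent sets of $M$ with at most $r(M)-1$ elements. Elements $x,y$ of a matroid are clones if the bijection of the ground set that interchanges $x$ and $y$ and fixes every other element is an automorphism. -}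

module Defs where

open import Data.Nat using (ℕ; zero; suc; _≤_; _<_; _⊔_; _∸_)
import Data.Nat as ℕ
open import Data.Bool using (Bool; true; false)
import Data.Bool as B
open import Data.Fin using (Fin)
open import Data.Fin.Subset public
  using (Subset; inside; outside; ⊥; ⊤; ⁅_⁆; _∈_; _∉_; _⊆_; _∪_; ∣_∣)
open import Data.Fin.Subset.Properties using (_∈?_; _⊆?_)
open import Data.Fin.Permutation.Components using (transpose)
open import Data.Vec using (Vec; []; _∷_; lookup; tabulate)
open import Data.Vec.Properties using (≡-dec)
open import Data.List using (List; []; _∷_; _++_; map; filter; length; foldr)
open import Data.Product using (Σ; _×_; _,_; ∃)
open import Relation.Nullary using (¬_; Dec; yes; no; ⌊_⌋)
open import Relation.Nullary.Decidable using (_×-dec_)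
open import Relation.Binary.PropositionalEquality using (_≡_; _≢_)
open import Function.Bundles using (_⇔_)

allSubsets : (n : ℕ) → List (Subset n)
allSubsets zero    = [] ∷ []
allSubsets (suc n) = map (inside ∷_) (allSubsets n) ++ map (outside ∷_) (allSubsets n)

_≟ˢ_ : ∀ {n} (X Y : Subset n) → Dec (X ≡ Y)
_≟ˢ_ = ≡-dec B._≟_

record Matroid (n : ℕ) : Set₁ where
  field
    Indep     : Subset n → Set
    Indep?    : ∀ X → Dec (Indep X)
    indep-⊥   : Indep ⊥
    indep-⊆   : ∀ {X Y} → X ⊆ Y → Indep Y → Indep X
    augment   : ∀ {X Y} → Indep X → Indep Y → ∣ X ∣ < ∣ Y ∣ →
                ∃ λ e → e ∈ Y × e ∉ X × Indep (⁅ e ⁆ ∪ X)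

module _ {n : ℕ} (M : Matroid n) where
  open Matroid M

  rank : Subset n → ℕ
  rank X = foldr (λ I m → ∣ I ∣ ⊔ m) 0
             (filter (λ I → (I ⊆? X) ×-dec Indep? I) (allSubsets n))

  rk : ℕ
  rk = rank ⊤

  cl : Subset n → Subset n
  cl X = tabulate (λ e → ⌊ rank (⁅ e ⁆ ∪ X) ℕ.≟ rank X ⌋)

  IsFlat : Subset n → Set
  IsFlat F = cl F ≡ F

  FlatOfRankContaining : ℕ → Fin n → Subset n → Set
  FlatOfRankContaining k e F = IsFlat F × rank F ≡ k × e ∈ F

  FlatOfRankContaining? : ∀ k e F → Dec (FlatOfRankContaining k e F)
  FlatOfRankContaining? k e F = (cl F ≟ˢ F) ×-dec (rank F ℕ.≟ k) ×-dec (e ∈? F)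

  W : ℕ → Fin n → ℕ
  W k e = length (filter (FlatOfRankContaining? k e) (allSubsets n))

  Circuit : Subset n → Set
  Circuit C = ¬ Indep C × (∀ D → D ⊆ C → D ≢ C → Indep D)

  Freer : Fin n → Fin n → Set
  Freer f g = ∀ C → Circuit C → f ∈ C → g ∈ cl C

-- Generic notions for a matroid given by a ground set E ⊆ Fin n
-- (as a predicate) and its independent sets.

SubsetOfGround : ∀ {n} → (Fin n → Set) → Subset n → Set
SubsetOfGround E X = ∀ x → x ∈ X → E x

module _ {n : ℕ} (E : Fin n → Set) (I : Subset n → Set) where

  CircuitOf : Subset n → Set
  CircuitOf C = SubsetOfGround E C × ¬ I C × (∀ D → D ⊆ C → D ≢ C → I D)

  ParallelIn : Fin n → Fin n → Set
  ParallelIn x y = x ≢ y × CircuitOf (⁅ x ⁆ ∪ ⁅ y ⁆)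

  swapImage : Fin n → Fin n → Subset n → Subset n
  swapImage x y X = tabulate (λ e → lookup X (transpose x y e))

  -- x, y are clones: the transposition of x and y (fixing every other
  -- element of E) is an automorphism, i.e. preserves independence
  ClonesIn : Fin n → Fin n → Set
  ClonesIn x y = E x × E y ×
    (∀ X → SubsetOfGround E X → (I X ⇔ I (swapImage x y X)))

delGround : ∀ {n} → (Fin n → Set) → (Fin n → Set) → (Fin n → Set)
delGround E D x = E x × ¬ D x

delIndep : ∀ {n} → (Fin n → Set) → (Fin n → Set) → (Subset n → Set) → (Subset n → Set)
delIndep E D I X = SubsetOfGround (delGround E D) X × I X

-- Truncation τ(M) (for r(M) > 0): ground set E(M), independent sets the
-- independent sets of M with at most r(M) - 1 elements.

τGround : ∀ {n} → Matroid n → Fin n → Set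
τGround M x = x ∈ ⊤

τIndep : ∀ {n} → Matroid n → Subset n → Set
τIndep M X = Matroid.Indep M X × ∣ X ∣ ≤ rk M ∸ 1

toDelete : ∀ {n} → Matroid n → Fin n → Fin n → Fin n → Set
toDelete M f g x = x ≢ f × x ≢ g × ParallelIn (τGround M) (τIndep M) x g

-- Ground set and independent sets of τ(M) \ toDelete
NGround : ∀ {n} → Matroid n → Fin n → Fin n → Fin n → Set
NGround M f g = delGround (τGround M) (toDelete M f g)

NIndep : ∀ {n} → Matroid n → Fin n → Fin n → Subset n → Set
NIndep M f g = delIndep (τGround M) (toDelete M f g) (τIndep M)

-- Let r = r(M) and call a rank-(r - 2) flat separating for (x, y) if it contains x but not y.
-- Flats containing both f and g count towards both W's, so W_{r-2}(f) = W_{r-2}(g) says that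
-- (f, g) and (g, f) have equally many separating flats. Since f is freer than g, f is a coloop
-- of every flat F separating for (f, g), and F ↦ cl((F - f) ∪ g) maps these flats to flats
-- separating for (g, f). If g is not a loop this map is onto: G ↦ cl((B - g) ∪ f), for a basis
-- B of G through g, is a section. Being clones in the deletion N of τ(M) amounts to: for every
-- Y ⊆ E(N) avoiding f and g, if Y ∪ f is independent in τ(M) then so is Y ∪ g (the converse is
-- freeness). If this holds, the map is injective, so the counts agree. If it fails for Y, a
-- circuit C ⊆ Y ∪ g through g has two further elements a ≠ b, as a lone one would be parallel
-- to g in τ(M) and so deleted. Extending C - g to S with S ∪ f independent of size r - 2, the
-- flats cl((S - a) ∪ f) and cl((S - b) ∪ f) differ but both map to cl(S), so the counts differ.
-- A loop lies in every flat, which settles the case that g is a loop.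

module Submission where

open import Defs
open import Data.Nat using (ℕ; zero; suc; _+_; _≤_; _<_; _∸_; _⊔_; z≤n; s≤s)
open import Data.Nat.Properties
  using (≤-refl; ≤-trans; ≤-reflexive; ≤-antisym; <-irrefl; ≤∧≢⇒<; ≤-pred; <⇒≤; 1+n≰n; n≤0⇒n≡0;
         m≤n⇒m<n∨m≡n; m≤m⊔n; m≤n⊔m; ⊔-sel; ∸-monoˡ-≤; n≤1+n; +-cancelˡ-≡; +-suc; +-comm; m∸n+n≡m;
         suc-injective; module ≤-Reasoning)
import Data.Nat as ℕ
open import Data.Bool using (Bool; true; false)
open import Data.Bool.Properties using (T-≡)
open import Data.Fin using (Fin; zero; suc) renaming (_≟_ to _≟ᶠ_)
open import Data.Fin.Properties using (any?; injective⇒≤)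
open import Data.Fin.Subset using (_-_; _⊂_)
open import Data.Fin.Subset.Properties
  using (_∈?_; _⊆?_; ∈⊤; ∉⊥; ⊥⊆; ∣⊥∣≡0; ∪-identityˡ; x∈⁅x⁆; x∈⁅y⁆⇒x≡y; ∣⁅x⁆∣≡1; x∈p∪q⁺;
         x∈p∪q⁻; p─q⊆p; x∈p∧x≢y⇒x∈p-y; ⊆-refl; ⊆-antisym; p⊆q⇒∣p∣≤∣q∣; p⊂q⇒∣p∣<∣q∣)
open import Data.Fin.Permutation.Components using (transpose)
open import Data.Vec using ([]; _∷_; here; there; lookup; tabulate)
open import Data.Vec.Properties using (∷-injectiveʳ; tabulate-cong; lookup∘tabulate; []=⇒lookup; lookup⇒[]=)
open import Data.List using (List; []; _∷_; map; filter; foldr; length)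
import Data.List as List
open import Data.List.Properties using (filter-≐; filter-none; filter-some)
open import Data.List.Membership.Propositional using () renaming (_∈_ to _∈ₗ_)
open import Data.List.Membership.Propositional.Properties
  using (∈-lookup; ∈-map⁺; ∈-map⁻; ∈-++⁺ˡ; ∈-++⁺ʳ; ∈-filter⁺; ∈-filter⁻)
open import Data.List.Membership.Setoid.Properties using (index-injective)
open import Data.List.Relation.Unary.Any using (index)
import Data.List.Relation.Unary.Any as Any
import Data.List.Relation.Unary.All as All
open import Data.List.Relation.Unary.AllPairs using ([]; _∷_)
open import Data.List.Relation.Unary.Unique.Propositional using (Unique)
import Data.List.Relation.Unary.Unique.Propositional.Properties as Unique
open import Data.Product using (_×_; _,_; proj₁; proj₂; ∃; ∃-syntax)
open import Data.Sum using (_⊎_; inj₁; inj₂; [_,_])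
open import Data.Empty using (⊥-elim)
open import Function using (_∘_)
open import Function.Definitions using (Injective)
open import Function.Bundles using (_⇔_; mk⇔; Equivalence)
import Function.Properties.Equivalence as ⇔
open import Relation.Nullary using (¬_; Dec; yes; no; contradiction)
open import Relation.Nullary.Decidable using (_×-dec_; ¬?; decidable-stable; toWitness; fromWitness)
open import Relation.Unary using (Decidable)
open import Relation.Unary.Properties using (_∩?_; ∁?)
open import Relation.Binary.PropositionalEquality
  using (_≡_; _≢_; refl; sym; trans; cong; cong₂; subst; subst₂; setoid; module ≡-Reasoning)

-- Counting along injections between lists

module _ {A : Set} where

  lookup-injective : ∀ {xs : List A} → Unique xs → Injective _≡_ _≡_ (List.lookup xs)
  lookup-injective {xs = _ ∷ _} (_ ∷ _) {zero} {zero} _ = refl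
  lookup-injective {xs = _ ∷ _} (x≢ ∷ _) {zero} {suc j} eq = contradiction eq (All.lookup x≢ (∈-lookup j))
  lookup-injective {xs = _ ∷ _} (x≢ ∷ _) {suc i} {zero} eq = contradiction (sym eq) (All.lookup x≢ (∈-lookup i))
  lookup-injective {xs = _ ∷ _} (_ ∷ xs!) {suc i} {suc j} eq = cong suc (lookup-injective xs! eq)

  length-filter-∩ : ∀ {P Q : A → Set} (P? : Decidable P) (Q? : Decidable Q) xs →
    length (filter P? xs) ≡ length (filter (P? ∩? Q?) xs) + length (filter (P? ∩? ∁? Q?) xs)
  length-filter-∩ P? Q? [] = refl
  length-filter-∩ P? Q? (x ∷ xs) with P? x | Q? x
  ... | yes _ | yes _ = cong suc (length-filter-∩ P? Q? xs)
  ... | yes _ | no _ = trans (cong suc (length-filter-∩ P? Q? xs)) (sym (+-suc _ _))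
  ... | no _ | _ = length-filter-∩ P? Q? xs

module _ {A B : Set} (h : A → B) {xs : List A} {ys : List B} (xs! : Unique xs)
         (h-into : ∀ {x} → x ∈ₗ xs → h x ∈ₗ ys)
         (h-injective : ∀ {x x′} → x ∈ₗ xs → x′ ∈ₗ xs → h x ≡ h x′ → x ≡ x′) where

  private
    position : Fin (length xs) → Fin (length ys)
    position i = index (h-into (∈-lookup i))

    position-injective : Injective _≡_ _≡_ position
    position-injective {i} {j} eq = lookup-injective xs! (h-injective (∈-lookup i) (∈-lookup j)
      (index-injective (setoid B) (h-into (∈-lookup i)) (h-into (∈-lookup j)) eq))

  length-≤-injectiveOn : length xs ≤ length ys
  length-≤-injectiveOn = injective⇒≤ position-injective

  length-<-injectiveOn : ∀ {y} → y ∈ₗ ys → (∀ {x} → x ∈ₗ xs → h x ≢ y) → length xs < length ys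
  length-<-injectiveOn {y} y∈ys missed = injective⇒≤ {f = position′} position′-injective
    where
    position′ : Fin (suc (length xs)) → Fin (length ys)
    position′ zero = index y∈ys
    position′ (suc i) = position i

    position′-injective : Injective _≡_ _≡_ position′
    position′-injective {zero} {zero} _ = refl
    position′-injective {zero} {suc j} eq =
      contradiction (sym (index-injective (setoid B) y∈ys (h-into (∈-lookup j)) eq)) (missed (∈-lookup j))
    position′-injective {suc i} {zero} eq =
      contradiction (index-injective (setoid B) (h-into (∈-lookup i)) y∈ys eq) (missed (∈-lookup i))
    position′-injective {suc i} {suc j} eq = cong suc (position-injective eq)

-- Finite subsets

private variable
  n : ℕ
  x y z : Fin n
  X Y : Subset n

allSubsets-complete : (X : Subset n) → X ∈ₗ allSubsets n
allSubsets-complete [] = Any.here refl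
allSubsets-complete (true ∷ X) = ∈-++⁺ˡ (∈-map⁺ (true ∷_) (allSubsets-complete X))
allSubsets-complete {suc n} (false ∷ X) =
  ∈-++⁺ʳ (map (true ∷_) (allSubsets n)) (∈-map⁺ (false ∷_) (allSubsets-complete X))

allSubsets-unique : ∀ n → Unique (allSubsets n)
allSubsets-unique zero = All.[] ∷ []
allSubsets-unique (suc n) =
  Unique.++⁺ (Unique.map⁺ ∷-injectiveʳ (allSubsets-unique n)) (Unique.map⁺ ∷-injectiveʳ (allSubsets-unique n))
             heads-differ
  where
  heads-differ : ∀ {X} → ¬ (X ∈ₗ map (true ∷_) (allSubsets n) × X ∈ₗ map (false ∷_) (allSubsets n))
  heads-differ (p , q) with ∈-map⁻ (true ∷_) p | ∈-map⁻ (false ∷_) q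
  ... | _ , _ , refl | _ , _ , ()

⊆-or-witness : (X Y : Subset n) → X ⊆ Y ⊎ ∃[ x ] x ∈ X × x ∉ Y
⊆-or-witness X Y with any? (λ x → x ∈? X ×-dec ¬? (x ∈? Y))
... | yes witness = inj₂ witness
... | no none = inj₁ λ {x} x∈X → decidable-stable (x ∈? Y) (λ x∉Y → none (x , x∈X , x∉Y))

⊆∧≢⇒⊂ : X ⊆ Y → X ≢ Y → X ⊂ Y
⊆∧≢⇒⊂ {X = X} {Y} X⊆Y X≢Y with ⊆-or-witness Y X
... | inj₁ Y⊆X = contradiction (⊆-antisym X⊆Y Y⊆X) X≢Y
... | inj₂ witness = X⊆Y , witness

∈⇔lookup : x ∈ X ⇔ lookup X x ≡ true
∈⇔lookup {x = x} {X} = mk⇔ []=⇒lookup (lookup⇒[]= x X)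

∈-tabulate : (h : Fin n → Bool) → x ∈ tabulate h ⇔ h x ≡ true
∈-tabulate {x = x} h = mk⇔ (λ p → trans (sym (lookup∘tabulate h x)) (Equivalence.to ∈⇔lookup p))
                            (λ eq → Equivalence.from ∈⇔lookup (trans (lookup∘tabulate h x) eq))

⁅⁆-⊆ : x ∈ X → ⁅ x ⁆ ⊆ X
⁅⁆-⊆ {x = x} {X} x∈X y∈⁅x⁆ = subst (_∈ X) (sym (x∈⁅y⁆⇒x≡y x y∈⁅x⁆)) x∈X

insert : Fin n → Subset n → Subset n
insert x X = ⁅ x ⁆ ∪ X

∈-insert-here : x ∈ insert x X
∈-insert-here {x = x} = x∈p∪q⁺ (inj₁ (x∈⁅x⁆ x))

∈-insert-there : y ∈ X → y ∈ insert x X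
∈-insert-there y∈X = x∈p∪q⁺ (inj₂ y∈X)

∈-insert⁻ : y ∈ insert x X → y ≡ x ⊎ y ∈ X
∈-insert⁻ {x = x} {X} y∈ = [ inj₁ ∘ x∈⁅y⁆⇒x≡y x , inj₂ ] (x∈p∪q⁻ ⁅ x ⁆ X y∈)

insert-⊆ : x ∈ Y → X ⊆ Y → insert x X ⊆ Y
insert-⊆ x∈Y X⊆Y y∈ with ∈-insert⁻ y∈
... | inj₁ refl = x∈Y
... | inj₂ y∈X = X⊆Y y∈X

insert-mono : X ⊆ Y → insert x X ⊆ insert x Y
insert-mono X⊆Y = insert-⊆ ∈-insert-here (λ y∈X → ∈-insert-there (X⊆Y y∈X))

insert-comm : insert x (insert y X) ⊆ insert y (insert x X)
insert-comm = insert-⊆ (∈-insert-there ∈-insert-here) (insert-mono ∈-insert-there)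

insert-∈ : x ∈ X → insert x X ≡ X
insert-∈ x∈X = ⊆-antisym (insert-⊆ x∈X ⊆-refl) ∈-insert-there

⊆insert⇒⊆ : X ⊆ insert x Y → x ∉ X → X ⊆ Y
⊆insert⇒⊆ X⊆ x∉X y∈X with ∈-insert⁻ (X⊆ y∈X)
... | inj₁ refl = contradiction y∈X x∉X
... | inj₂ y∈Y = y∈Y

∣insert∣ : x ∉ X → ∣ insert x X ∣ ≡ suc ∣ X ∣
∣insert∣ {x = zero} {true ∷ X} x∉X = contradiction here x∉X
∣insert∣ {x = zero} {false ∷ X} _ = cong (suc ∘ ∣_∣) (∪-identityˡ X)
∣insert∣ {x = suc x} {true ∷ X} x∉X = cong suc (∣insert∣ (x∉X ∘ there))
∣insert∣ {x = suc x} {false ∷ X} x∉X = ∣insert∣ (x∉X ∘ there)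

remove-⊆ : X - x ⊆ X
remove-⊆ {X = X} {x} = p─q⊆p X ⁅ x ⁆

x∉X-x : x ∉ X - x
x∉X-x {x = zero} {_ ∷ X} ()
x∉X-x {x = suc x} {_ ∷ X} (there x∈) = x∉X-x x∈

∈-remove⁺ : y ∈ X → y ≢ x → y ∈ X - x
∈-remove⁺ = x∈p∧x≢y⇒x∈p-y

∈-remove⁻ : y ∈ X - x → y ≢ x
∈-remove⁻ y∈ refl = x∉X-x y∈

⊆insert⇒remove⊆ : X ⊆ insert x Y → X - x ⊆ Y
⊆insert⇒remove⊆ X⊆ y∈ = ⊆insert⇒⊆ (λ p → X⊆ (remove-⊆ p)) x∉X-x y∈

insert-remove : x ∈ X → insert x (X - x) ≡ X
insert-remove {x = x} x∈X = ⊆-antisym (insert-⊆ x∈X remove-⊆) back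
  where
  back : ∀ {y} → y ∈ _ → y ∈ insert x (_ - x)
  back {y} y∈X with y ≟ᶠ x
  ... | yes refl = ∈-insert-here
  ... | no y≢x = ∈-insert-there (∈-remove⁺ y∈X y≢x)

∣remove∣ : x ∈ X → ∣ X ∣ ≡ suc ∣ X - x ∣
∣remove∣ {x = x} {X} x∈X = trans (cong ∣_∣ (sym (insert-remove x∈X))) (∣insert∣ {x = x} {X - x} x∉X-x)

∣pair∣ : x ≢ y → ∣ insert x ⁅ y ⁆ ∣ ≡ 2
∣pair∣ {y = y} x≢y = trans (∣insert∣ (x≢y ∘ x∈⁅y⁆⇒x≡y y)) (cong suc (∣⁅x⁆∣≡1 y))

remove-insert : x ∉ X → insert x X - x ≡ X
remove-insert x∉X =
  ⊆-antisym (⊆insert⇒remove⊆ ⊆-refl) (λ y∈X → ∈-remove⁺ (∈-insert-there y∈X) (λ { refl → x∉X y∈X }))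

-- Transpositions and clones

transpose-matchˡ : (x y : Fin n) → transpose x y x ≡ y
transpose-matchˡ x y with x ≟ᶠ x
... | yes _ = refl
... | no x≢x = contradiction refl x≢x

transpose-matchʳ : (x y : Fin n) → transpose x y y ≡ x
transpose-matchʳ x y with y ≟ᶠ x
... | yes y≡x = y≡x
... | no _ with y ≟ᶠ y
...   | yes _ = refl
...   | no y≢y = contradiction refl y≢y

transpose-other : z ≢ x → z ≢ y → transpose x y z ≡ z
transpose-other {z = z} {x} {y} z≢x z≢y with z ≟ᶠ x
... | yes z≡x = contradiction z≡x z≢x
... | no _ with z ≟ᶠ y
...   | yes z≡y = contradiction z≡y z≢y
...   | no _ = refl

transpose-comm : (x y z : Fin n) → transpose x y z ≡ transpose y x z
transpose-comm x y z = by-cases (z ≟ᶠ x) (z ≟ᶠ y)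
  where
  by-cases : Dec (z ≡ x) → Dec (z ≡ y) → transpose x y z ≡ transpose y x z
  by-cases (yes refl) (yes refl) = refl
  by-cases (yes refl) (no _) = trans (transpose-matchˡ z y) (sym (transpose-matchʳ y z))
  by-cases (no _) (yes refl) = trans (transpose-matchʳ x z) (sym (transpose-matchˡ z x))
  by-cases (no z≢x) (no z≢y) = trans (transpose-other z≢x z≢y) (sym (transpose-other z≢y z≢x))

-- This is swapImage E I x y, which does not depend on E and I.
transposeImage : Fin n → Fin n → Subset n → Subset n
transposeImage x y X = tabulate (λ z → lookup X (transpose x y z))

∈-transposeImage : z ∈ transposeImage x y X ⇔ transpose x y z ∈ X
∈-transposeImage = ⇔.trans (∈-tabulate _) (⇔.sym ∈⇔lookup)

transposeImage-comm : transposeImage x y X ≡ transposeImage y x X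
transposeImage-comm {x = x} {y} {X} = tabulate-cong (λ z → cong (lookup X) (transpose-comm x y z))

transposeImage-fixes : (x ∈ X → y ∈ X) → (y ∈ X → x ∈ X) → transposeImage x y X ≡ X
transposeImage-fixes {x = x} {X} {y} x⇒y y⇒x = ⊆-antisym into onto
  where
  into : transposeImage x y X ⊆ X
  into {z} z∈ with z ≟ᶠ x | z ≟ᶠ y | Equivalence.to ∈-transposeImage z∈
  ... | yes refl | _ | τz∈X = y⇒x (subst (_∈ X) (transpose-matchˡ x y) τz∈X)
  ... | no _ | yes refl | τz∈X = x⇒y (subst (_∈ X) (transpose-matchʳ x y) τz∈X)
  ... | no z≢x | no z≢y | τz∈X = subst (_∈ X) (transpose-other z≢x z≢y) τz∈X
  onto : X ⊆ transposeImage x y X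
  onto {z} z∈X = Equivalence.from ∈-transposeImage (τz∈X (z ≟ᶠ x) (z ≟ᶠ y))
    where
    τz∈X : Dec (z ≡ x) → Dec (z ≡ y) → transpose x y z ∈ X
    τz∈X (yes refl) _ = subst (_∈ X) (sym (transpose-matchˡ x y)) (x⇒y z∈X)
    τz∈X (no _) (yes refl) = subst (_∈ X) (sym (transpose-matchʳ x y)) (y⇒x z∈X)
    τz∈X (no z≢x) (no z≢y) = subst (_∈ X) (sym (transpose-other z≢x z≢y)) z∈X

transposeImage-moves : x ∈ X → y ∉ X → transposeImage x y X ≡ insert y (X - x)
transposeImage-moves {x = x} {X} {y} x∈X y∉X = ⊆-antisym into onto
  where
  into : transposeImage x y X ⊆ insert y (X - x)
  into {z} z∈ with z ≟ᶠ x | z ≟ᶠ y | Equivalence.to ∈-transposeImage z∈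
  ... | yes refl | _ | τz∈X = contradiction (subst (_∈ X) (transpose-matchˡ x y) τz∈X) y∉X
  ... | no _ | yes refl | _ = ∈-insert-here
  ... | no z≢x | no z≢y | τz∈X = ∈-insert-there (∈-remove⁺ (subst (_∈ X) (transpose-other z≢x z≢y) τz∈X) z≢x)
  onto : insert y (X - x) ⊆ transposeImage x y X
  onto {z} z∈ with ∈-insert⁻ z∈
  ... | inj₁ refl = Equivalence.from ∈-transposeImage (subst (_∈ X) (sym (transpose-matchʳ x y)) x∈X)
  ... | inj₂ z∈X-x = Equivalence.from ∈-transposeImage (subst (_∈ X) (sym (transpose-other z≢x z≢y)) z∈X)
    where
    z∈X : z ∈ X
    z∈X = remove-⊆ z∈X-x
    z≢x : z ≢ x
    z≢x = ∈-remove⁻ z∈X-x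
    z≢y : z ≢ y
    z≢y refl = y∉X z∈X

Interchangeable : (Fin n → Set) → (Subset n → Set) → Fin n → Fin n → Set
Interchangeable E I x y = ∀ {Y} → SubsetOfGround E Y → x ∉ Y → y ∉ Y → I (insert x Y) ⇔ I (insert y Y)

module _ (E : Fin n → Set) (I : Subset n → Set) {x y : Fin n} (x≢y : x ≢ y) (Ex : E x) (Ey : E y) where

  clones⇔interchangeable : ClonesIn E I x y ⇔ Interchangeable E I x y
  clones⇔interchangeable = mk⇔ interchangeable clones
    where
    interchangeable : ClonesIn E I x y → Interchangeable E I x y
    interchangeable (_ , _ , preserves) {Y} Y⊆E x∉Y y∉Y =
      subst (λ Z → I (insert x Y) ⇔ I Z)
            (trans (transposeImage-moves ∈-insert-here (λ y∈ → [ x≢y ∘ sym , y∉Y ] (∈-insert⁻ y∈)))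
                   (cong (insert y) (remove-insert x∉Y)))
            (preserves (insert x Y) (λ z z∈ → [ (λ { refl → Ex }) , Y⊆E z ] (∈-insert⁻ z∈)))
    clones : Interchangeable E I x y → ClonesIn E I x y
    clones interchange = Ex , Ey , preserves
      where
      preserves : ∀ X → SubsetOfGround E X → I X ⇔ I (transposeImage x y X)
      preserves X X⊆E with x ∈? X | y ∈? X
      ... | yes x∈X | yes y∈X =
        subst (λ Z → I X ⇔ I Z) (sym (transposeImage-fixes (λ _ → y∈X) (λ _ → x∈X))) ⇔.refl
      ... | no x∉X | no y∉X =
        subst (λ Z → I X ⇔ I Z) (sym (transposeImage-fixes (⊥-elim ∘ x∉X) (⊥-elim ∘ y∉X))) ⇔.refl
      ... | yes x∈X | no y∉X =
        subst₂ (λ Z Z′ → I Z ⇔ I Z′) (insert-remove x∈X) (sym (transposeImage-moves x∈X y∉X))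
               (interchange (λ z z∈ → X⊆E z (remove-⊆ z∈)) x∉X-x (y∉X ∘ remove-⊆))
      ... | no x∉X | yes y∈X =
        subst₂ (λ Z Z′ → I Z ⇔ I Z′) (insert-remove y∈X)
               (sym (trans (transposeImage-comm {x = x} {y} {X}) (transposeImage-moves y∈X x∉X)))
               (⇔.sym (interchange (λ z z∈ → X⊆E z (remove-⊆ z∈)) (x∉X ∘ remove-⊆) x∉X-x))

-- Rank, bases, closure and circuits

maxSize : List (Subset n) → ℕ
maxSize = foldr (λ I m → ∣ I ∣ ⊔ m) 0

∣∣≤maxSize : ∀ {I : Subset n} {Is} → I ∈ₗ Is → ∣ I ∣ ≤ maxSize Is
∣∣≤maxSize (Any.here refl) = m≤m⊔n _ _
∣∣≤maxSize {Is = J ∷ _} (Any.there I∈) = ≤-trans (∣∣≤maxSize I∈) (m≤n⊔m ∣ J ∣ _)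

maxSize-attained : (Is : List (Subset n)) → maxSize Is ≡ 0 ⊎ ∃[ I ] I ∈ₗ Is × ∣ I ∣ ≡ maxSize Is
maxSize-attained [] = inj₁ refl
maxSize-attained (J ∷ Is) with ⊔-sel ∣ J ∣ (maxSize Is) | maxSize-attained Is
... | inj₁ eq | _ = inj₂ (J , Any.here refl , sym eq)
... | inj₂ eq | inj₁ rest≡0 = inj₁ (trans eq rest≡0)
... | inj₂ eq | inj₂ (I , I∈ , size) = inj₂ (I , Any.there I∈ , trans size (sym eq))

module MatroidProperties (M : Matroid n) where
  open Matroid M

  private variable
    I J J′ C F : Subset n

  record Basis (X J : Subset n) : Set where
    constructor mkBasis
    field
      indep : Indep J
      ⊆-set : J ⊆ X
      size : ∣ J ∣ ≡ rank M X

  indep⇒∣∣≤rank : Indep I → I ⊆ X → ∣ I ∣ ≤ rank M X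
  indep⇒∣∣≤rank i I⊆X =
    ∣∣≤maxSize (∈-filter⁺ (λ J → (J ⊆? _) ×-dec Indep? J) (allSubsets-complete _) (I⊆X , i))

  basis-exists : ∀ X → ∃ (Basis X)
  basis-exists X with maxSize-attained (filter (λ J → (J ⊆? X) ×-dec Indep? J) (allSubsets n))
  ... | inj₁ rank≡0 = ⊥ , mkBasis indep-⊥ ⊥⊆ (trans (∣⊥∣≡0 n) (sym rank≡0))
  ... | inj₂ (J , J∈ , size) with ∈-filter⁻ (λ J → (J ⊆? X) ×-dec Indep? J) {xs = allSubsets n} J∈
  ...   | _ , J⊆X , i = J , mkBasis i J⊆X size

  augment-within : Indep I → I ⊆ X → ∣ I ∣ < rank M X → ∃[ x ] x ∈ X × x ∉ I × Indep (insert x I)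
  augment-within i I⊆X ∣I∣<rank with basis-exists _
  ... | B , mkBasis iB B⊆X size with augment i iB (subst (_ <_) (sym size) ∣I∣<rank)
  ...   | x , x∈B , x∉I , i′ = x , B⊆X x∈B , x∉I , i′

  basis-maximal : Basis X J → x ∈ X → x ∉ J → ¬ Indep (insert x J)
  basis-maximal {X} {J} {x} (mkBasis _ J⊆X size) x∈X x∉J i = 1+n≰n (begin
    suc (rank M X)    ≡⟨ cong suc size ⟨
    suc ∣ J ∣         ≡⟨ ∣insert∣ x∉J ⟨
    ∣ insert x J ∣    ≤⟨ indep⇒∣∣≤rank i (insert-⊆ x∈X J⊆X) ⟩
    rank M X          ∎)
    where open ≤-Reasoning

  maximal⇒basis : Indep J → J ⊆ X → (∀ {x} → x ∈ X → x ∉ J → ¬ Indep (insert x J)) → Basis X J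
  maximal⇒basis i J⊆X maximal with m≤n⇒m<n∨m≡n (indep⇒∣∣≤rank i J⊆X)
  ... | inj₂ size = mkBasis i J⊆X size
  ... | inj₁ ∣J∣<rank with augment-within i J⊆X ∣J∣<rank
  ...   | x , x∈X , x∉J , i′ = contradiction i′ (maximal x∈X x∉J)

  extend-to-size : ∀ m → Indep I → I ⊆ X → ∣ I ∣ ≤ m → m ≤ rank M X →
                   ∃[ J ] I ⊆ J × J ⊆ X × Indep J × ∣ J ∣ ≡ m
  extend-to-size {I} zero i I⊆X ∣I∣≤0 _ = I , ⊆-refl , I⊆X , i , n≤0⇒n≡0 ∣I∣≤0
  extend-to-size {I} (suc m) i I⊆X ∣I∣≤ m<rank with ∣ I ∣ ℕ.≟ suc m
  ... | yes size = I , ⊆-refl , I⊆X , i , size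
  ... | no size≢ with extend-to-size m i I⊆X (≤-pred (≤∧≢⇒< ∣I∣≤ size≢)) (<⇒≤ m<rank)
  ...   | J , I⊆J , J⊆X , iJ , size with augment-within iJ J⊆X (subst (_< _) (sym size) m<rank)
  ...     | x , x∈X , x∉J , i′ =
    insert x J , (λ p → ∈-insert-there (I⊆J p)) , insert-⊆ x∈X J⊆X , i′ , trans (∣insert∣ x∉J) (cong suc size)

  extend-to-basis : Indep I → I ⊆ X → ∃[ J ] I ⊆ J × Basis X J
  extend-to-basis i I⊆X with extend-to-size _ i I⊆X (indep⇒∣∣≤rank i I⊆X) ≤-refl
  ... | J , I⊆J , J⊆X , iJ , size = J , I⊆J , mkBasis iJ J⊆X size

  indep⇒basis : Indep J → Basis J J
  indep⇒basis i = maximal⇒basis i ⊆-refl (λ x∈J x∉J → contradiction x∈J x∉J)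

  rank-indep : Indep J → rank M J ≡ ∣ J ∣
  rank-indep i = sym (Basis.size (indep⇒basis i))

  basis-insert : Basis X J → Indep (insert x J) → Basis (insert x X) (insert x J)
  basis-insert {X} {J} {x} B i = maximal⇒basis i (insert-mono (Basis.⊆-set B)) maximal
    where
    maximal : y ∈ insert x X → y ∉ insert x J → ¬ Indep (insert y (insert x J))
    maximal y∈ y∉ with ∈-insert⁻ y∈
    ... | inj₁ refl = contradiction ∈-insert-here y∉
    ... | inj₂ y∈X = λ i′ → basis-maximal B y∈X (y∉ ∘ ∈-insert-there) (indep-⊆ (insert-mono ∈-insert-there) i′)

  Spans : Subset n → Fin n → Set
  Spans J x = x ∈ J ⊎ ¬ Indep (insert x J)

  spans⇒dependent : Spans J x → x ∉ J → ¬ Indep (insert x J)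
  spans⇒dependent (inj₁ x∈J) x∉J = contradiction x∈J x∉J
  spans⇒dependent (inj₂ dependent) _ = dependent

  spans-mono : J ⊆ J′ → Spans J x → Spans J′ x
  spans-mono J⊆J′ (inj₁ x∈J) = inj₁ (J⊆J′ x∈J)
  spans-mono J⊆J′ (inj₂ dependent) = inj₂ (λ i → dependent (indep-⊆ (insert-mono J⊆J′) i))

  basis-spans : Basis X J → x ∈ X → Spans J x
  basis-spans {J = J} {x} B x∈X with x ∈? J
  ... | yes x∈J = inj₁ x∈J
  ... | no x∉J = inj₂ (basis-maximal B x∈X x∉J)

  ∈cl⇔ : x ∈ cl M X ⇔ rank M (insert x X) ≡ rank M X
  ∈cl⇔ {x} {X} = ⇔.trans (∈-tabulate _)
    (mk⇔ (λ eq → toWitness (Equivalence.from T-≡ eq)) (λ eq → Equivalence.to T-≡ (fromWitness eq)))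

  spans⇒∈cl : Basis X J → Spans J x → x ∈ cl M X
  spans⇒∈cl {X} {J} {x} B spans = Equivalence.from ∈cl⇔ (trans (sym (Basis.size B′)) (Basis.size B))
    where
    B′ : Basis (insert x X) J
    B′ = maximal⇒basis (Basis.indep B) (λ p → ∈-insert-there (Basis.⊆-set B p)) maximal
      where
      maximal : y ∈ insert x X → y ∉ J → ¬ Indep (insert y J)
      maximal y∈ y∉J with ∈-insert⁻ y∈
      ... | inj₁ refl = spans⇒dependent spans y∉J
      ... | inj₂ y∈X = basis-maximal B y∈X y∉J

  ∈cl⇒spans : Basis X J → x ∈ cl M X → Spans J x
  ∈cl⇒spans {X} {J} {x} B x∈cl with x ∈? J
  ... | yes x∈J = inj₁ x∈J
  ... | no x∉J = inj₂ λ i → 1+n≰n (begin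
    suc (rank M X)         ≡⟨ cong suc (Basis.size B) ⟨
    suc ∣ J ∣              ≡⟨ ∣insert∣ x∉J ⟨
    ∣ insert x J ∣         ≤⟨ indep⇒∣∣≤rank i (insert-mono (Basis.⊆-set B)) ⟩
    rank M (insert x X)    ≡⟨ Equivalence.to ∈cl⇔ x∈cl ⟩
    rank M X               ∎)
    where open ≤-Reasoning

  ∉cl : Basis X J → x ∉ J → Indep (insert x J) → x ∉ cl M X
  ∉cl B x∉J i x∈cl = spans⇒dependent (∈cl⇒spans B x∈cl) x∉J i

  dependent⇒∈cl : Indep J → ¬ Indep (insert x J) → x ∈ cl M J
  dependent⇒∈cl i dependent = spans⇒∈cl (indep⇒basis i) (inj₂ dependent)

  indep⇒∉cl : Indep (insert x J) → x ∉ J → x ∉ cl M J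
  indep⇒∉cl i x∉J = ∉cl (indep⇒basis (indep-⊆ ∈-insert-there i)) x∉J i

  indep⇒∉cl-remove : Indep (insert y J) → y ∉ J → x ∈ J → x ∉ cl M (insert y (J - x))
  indep⇒∉cl-remove {y} {J} {x} i y∉J x∈J =
    indep⇒∉cl (indep-⊆ (insert-⊆ (∈-insert-there x∈J) (insert-mono remove-⊆)) i) x∉
    where
    x∉ : x ∉ insert y (J - x)
    x∉ p = [ (λ { refl → y∉J x∈J }) , x∉X-x ] (∈-insert⁻ p)

  ⊆-cl : X ⊆ cl M X
  ⊆-cl {X} x∈X = spans⇒∈cl (proj₂ (basis-exists X)) (basis-spans (proj₂ (basis-exists X)) x∈X)

  cl-mono : X ⊆ Y → cl M X ⊆ cl M Y
  cl-mono {X} X⊆Y x∈cl with basis-exists X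
  ... | J , B with extend-to-basis (Basis.indep B) (λ p → X⊆Y (Basis.⊆-set B p))
  ...   | J′ , J⊆J′ , B′ = spans⇒∈cl B′ (spans-mono J⊆J′ (∈cl⇒spans B x∈cl))

  basis-cl : Basis X J → Basis (cl M X) J
  basis-cl B = maximal⇒basis (Basis.indep B) (λ p → ⊆-cl (Basis.⊆-set B p))
                             (λ x∈cl → spans⇒dependent (∈cl⇒spans B x∈cl))

  basis⇒cl≡ : Basis X J → Basis Y J → cl M X ≡ cl M Y
  basis⇒cl≡ BX BY = ⊆-antisym (λ p → spans⇒∈cl BY (∈cl⇒spans BX p)) (λ p → spans⇒∈cl BX (∈cl⇒spans BY p))

  cl-isFlat : ∀ X → IsFlat M (cl M X)
  cl-isFlat X = basis⇒cl≡ (basis-cl (proj₂ (basis-exists X))) (proj₂ (basis-exists X))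

  rank-cl : ∀ X → rank M (cl M X) ≡ rank M X
  rank-cl X = trans (sym (Basis.size (basis-cl (proj₂ (basis-exists X))))) (Basis.size (proj₂ (basis-exists X)))

  flat-closed : IsFlat M F → x ∈ cl M F → x ∈ F
  flat-closed {x = x} F-flat = subst (x ∈_) F-flat

  loop∈flat : ¬ Indep ⁅ x ⁆ → IsFlat M F → x ∈ F
  loop∈flat {x} {F} loop F-flat with basis-exists F
  ... | J , B = flat-closed F-flat (spans⇒∈cl B (inj₂ (λ i → loop (indep-⊆ (⁅⁆-⊆ ∈-insert-here) i))))

  circuit-minus : Circuit M C → x ∈ C → Indep (C - x)
  circuit-minus {x = x} (_ , minimal) x∈C = minimal _ remove-⊆ (λ eq → x∉X-x (subst (x ∈_) (sym eq) x∈C))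

  circuit-spans : Circuit M C → x ∈ C → x ∈ cl M (C - x)
  circuit-spans circ x∈C =
    dependent⇒∈cl (circuit-minus circ x∈C) (λ i → proj₁ circ (subst Indep (insert-remove x∈C) i))

  circuit-basis : Circuit M C → x ∈ C → Basis C (C - x)
  circuit-basis {C} {x} circ x∈C = maximal⇒basis (circuit-minus circ x∈C) remove-⊆ maximal
    where
    maximal : y ∈ C → y ∉ C - x → ¬ Indep (insert y (C - x))
    maximal {y} y∈C y∉ with y ≟ᶠ x
    ... | yes refl = λ i → proj₁ circ (subst Indep (insert-remove x∈C) i)
    ... | no y≢x = contradiction (∈-remove⁺ y∈C y≢x) y∉

  private
    circuit-within : ∀ m X → ∣ X ∣ ≡ m → ¬ Indep X → ∃[ C ] C ⊆ X × Circuit M C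
    circuit-within m X size dependent with any? (λ x → x ∈? X ×-dec ¬? (Indep? (X - x)))
    circuit-within zero X size _ | yes (x , x∈X , _) = contradiction (trans (sym size) (∣remove∣ x∈X)) λ ()
    circuit-within (suc m) X size _ | yes (x , x∈X , dependent′)
      with circuit-within m (X - x) (suc-injective (trans (sym (∣remove∣ x∈X)) size)) dependent′
    ... | C , C⊆ , circ = C , (λ p → remove-⊆ (C⊆ p)) , circ
    circuit-within m X _ dependent | no none = X , ⊆-refl , dependent , minimal
      where
      minimal : ∀ D → D ⊆ X → D ≢ X → Indep D
      minimal D D⊆X D≢X with ⊆∧≢⇒⊂ D⊆X D≢X
      ... | _ , x , x∈X , x∉D = indep-⊆ (λ y∈D → ∈-remove⁺ (D⊆X y∈D) (λ { refl → x∉D y∈D }))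
                                         (decidable-stable (Indep? (X - x)) (λ dep → none (x , x∈X , dep)))

  dependent⇒circuit : ¬ Indep X → ∃[ C ] C ⊆ X × Circuit M C
  dependent⇒circuit = circuit-within _ _ refl

  circuit-through : Indep I → ¬ Indep (insert x I) → ∃[ C ] C ⊆ insert x I × Circuit M C × x ∈ C
  circuit-through {x = x} i dependent with dependent⇒circuit dependent
  ... | C , C⊆ , circ with x ∈? C
  ...   | yes x∈C = C , C⊆ , circ , x∈C
  ...   | no x∉C = contradiction (indep-⊆ (⊆insert⇒⊆ C⊆ x∉C) i) (proj₁ circ)

  freer⇒dependent : ∀ {f g} → Freer M f g → Indep I → g ∉ I → ¬ Indep (insert f I) → ¬ Indep (insert g I)
  freer⇒dependent freer i g∉I dependent with circuit-through i dependent
  ... | C , C⊆ , circ , f∈C with ∈cl⇒spans (circuit-basis circ f∈C) (freer C circ f∈C)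
  ...   | inj₁ g∈C-f = contradiction (⊆insert⇒remove⊆ C⊆ g∈C-f) g∉I
  ...   | inj₂ dependent′ = λ i′ → dependent′ (indep-⊆ (insert-mono (⊆insert⇒remove⊆ C⊆)) i′)

  circuit-exchange : Circuit M C → y ∈ C → x ∈ C → x ≢ y → C - y ⊆ I → Indep I → Indep (insert y (I - x))
  circuit-exchange {C} {y} {x} {I} circ y∈C x∈C x≢y C-y⊆I iI =
    decidable-stable (Indep? _) (λ dependent → x-not-spanned (∈cl⇒spans (indep⇒basis iI-x) (x∈cl dependent)))
    where
    iI-x : Indep (I - x)
    iI-x = indep-⊆ remove-⊆ iI
    C-x⊆cl : ¬ Indep (insert y (I - x)) → C - x ⊆ cl M (I - x)
    C-x⊆cl dependent {z} z∈ with z ≟ᶠ y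
    ... | yes refl = dependent⇒∈cl iI-x dependent
    ... | no z≢y = ⊆-cl (∈-remove⁺ (C-y⊆I (∈-remove⁺ (remove-⊆ z∈) z≢y)) (∈-remove⁻ z∈))
    x∈cl : ¬ Indep (insert y (I - x)) → x ∈ cl M (I - x)
    x∈cl dependent = flat-closed (cl-isFlat (I - x)) (cl-mono (C-x⊆cl dependent) (circuit-spans circ x∈C))
    x-not-spanned : ¬ Spans (I - x) x
    x-not-spanned (inj₁ x∈I-x) = x∉X-x x∈I-x
    x-not-spanned (inj₂ dependent) = dependent (subst Indep (sym (insert-remove (C-y⊆I (∈-remove⁺ x∈C x≢y)))) iI)

  circuit⇒τ-circuit : Circuit M C → ∣ C ∣ ≤ rk M → CircuitOf (τGround M) (τIndep M) C
  circuit⇒τ-circuit (dependent , minimal) ∣C∣≤rk =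
    (λ _ _ → ∈⊤) , (λ τi → dependent (proj₁ τi)) ,
    λ D D⊆C D≢C → minimal D D⊆C D≢C , ∸-monoˡ-≤ 1 (≤-trans (p⊂q⇒∣p∣<∣q∣ (⊆∧≢⇒⊂ D⊆C D≢C)) ∣C∣≤rk)

  τ-parallel⇒∈cl : 2 ≤ rk M ∸ 1 → ParallelIn (τGround M) (τIndep M) x y → y ∈ cl M ⁅ x ⁆
  τ-parallel⇒∈cl {x} {y} 2≤ (x≢y , _ , τ-dependent , τ-minimal) =
    dependent⇒∈cl indep-x (λ i → τ-dependent (indep-⊆ pair-comm i , subst (_≤ _) (sym (∣pair∣ x≢y)) 2≤))
    where
    ⁅x⁆≢⁅x,y⁆ : ⁅ x ⁆ ≢ insert x ⁅ y ⁆
    ⁅x⁆≢⁅x,y⁆ eq = x≢y (sym (x∈⁅y⁆⇒x≡y x (subst (y ∈_) (sym eq) (∈-insert-there (x∈⁅x⁆ y)))))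
    indep-x : Indep ⁅ x ⁆
    indep-x = proj₁ (τ-minimal ⁅ x ⁆ (⁅⁆-⊆ ∈-insert-here) ⁅x⁆≢⁅x,y⁆)
    pair-comm : insert x ⁅ y ⁆ ⊆ insert y ⁅ x ⁆
    pair-comm = insert-⊆ (∈-insert-there (x∈⁅x⁆ x)) (⁅⁆-⊆ ∈-insert-here)

module Exchange (M : Matroid n) {f g : Fin n} (f≢g : f ≢ g) (freer : Freer M f g) (k : ℕ) where
  open Matroid M
  open MatroidProperties M

  private variable
    C F F₁ F₂ G G′ S T : Subset n

  Separating : Fin n → Fin n → Subset n → Set
  Separating x y F = FlatOfRankContaining M k x F × y ∉ F

  exchange : Subset n → Subset n
  exchange F = cl M (insert g (F - f))

  record ExchangeBasis (F : Subset n) : Set where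
    field
      J : Subset n
      f∉J : f ∉ J
      g∉J : g ∉ J
      basis-F-f : Basis (F - f) J
      basis-F : Basis F (insert f J)
      basis-exchange : Basis (insert g (F - f)) (insert g J)
      size : suc ∣ J ∣ ≡ k

  exchangeBasis : Separating f g F → ExchangeBasis F
  exchangeBasis {F} ((F-flat , rank-F , f∈F) , g∉F) = record
    { J = J ; f∉J = f∉J ; g∉J = g∉J ; basis-F-f = B ; basis-F = basis-F
    ; basis-exchange = basis-insert B indep-gJ
    ; size = trans (sym (∣insert∣ f∉J)) (trans (Basis.size basis-F) rank-F)
    }
    where
    J : Subset n
    J = proj₁ (basis-exists (F - f))
    B : Basis (F - f) J
    B = proj₂ (basis-exists (F - f))
    f∉J : f ∉ J
    f∉J p = x∉X-x (Basis.⊆-set B p)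
    g∉J : g ∉ J
    g∉J p = g∉F (remove-⊆ (Basis.⊆-set B p))
    g∉cl : g ∉ cl M J
    g∉cl p = g∉F (flat-closed F-flat (cl-mono (λ q → remove-⊆ (Basis.⊆-set B q)) p))
    indep-gJ : Indep (insert g J)
    indep-gJ = decidable-stable (Indep? _) (λ dep → g∉cl (dependent⇒∈cl (Basis.indep B) dep))
    indep-fJ : Indep (insert f J)
    indep-fJ = decidable-stable (Indep? _)
      (λ dep → g∉cl (dependent⇒∈cl (Basis.indep B) (freer⇒dependent freer (Basis.indep B) g∉J dep)))
    basis-F : Basis F (insert f J)
    basis-F = subst (λ X → Basis X (insert f J)) (insert-remove f∈F) (basis-insert B indep-fJ)

  exchange-separating : Separating f g F → Separating g f (exchange F)
  exchange-separating {F} sep@((F-flat , _ , _) , g∉F) = (cl-isFlat _ , rank-exchange , ⊆-cl ∈-insert-here) , f∉exchange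
    where
    open ExchangeBasis (exchangeBasis sep)
    rank-exchange : rank M (exchange F) ≡ k
    rank-exchange = trans (rank-cl _) (trans (sym (Basis.size basis-exchange)) (trans (∣insert∣ g∉J) size))
    f∉exchange : f ∉ exchange F
    f∉exchange f∈ with ∈cl⇒spans basis-exchange f∈
    ... | inj₁ f∈gJ = [ f≢g , f∉J ] (∈-insert⁻ f∈gJ)
    ... | inj₂ dependent =
      g∉F (flat-closed F-flat (spans⇒∈cl basis-F (inj₂ (λ i → dependent (indep-⊆ insert-comm i)))))

  exchange-preimage : Separating g f G → g ∉ T → Basis G (insert g T) →
                      Separating f g (cl M (insert f T)) × exchange (cl M (insert f T)) ≡ G
  exchange-preimage {G} {T} ((G-flat , rank-G , _) , f∉G) g∉T B = sep , exchange-Fₜ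
    where
    indep-fgT : Indep (insert f (insert g T))
    indep-fgT = decidable-stable (Indep? _) (λ dep → f∉G (flat-closed G-flat (spans⇒∈cl B (inj₂ dep))))
    indep-fT : Indep (insert f T)
    indep-fT = indep-⊆ (insert-mono ∈-insert-there) indep-fgT
    f∉T : f ∉ T
    f∉T p = f∉G (Basis.⊆-set B (∈-insert-there p))
    size-T : suc ∣ T ∣ ≡ k
    size-T = trans (sym (∣insert∣ g∉T)) (trans (Basis.size B) rank-G)
    Fₜ : Subset n
    Fₜ = cl M (insert f T)
    sep : Separating f g Fₜ
    sep = ( cl-isFlat _
          , trans (rank-cl _) (trans (rank-indep indep-fT) (trans (∣insert∣ f∉T) size-T))
          , ⊆-cl ∈-insert-here )
        , indep⇒∉cl (indep-⊆ insert-comm indep-fgT) (λ p → [ f≢g ∘ sym , g∉T ] (∈-insert⁻ p))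
    open ExchangeBasis (exchangeBasis sep)
    basis-T : Basis (Fₜ - f) T
    basis-T = mkBasis (indep-⊆ ∈-insert-there indep-fT)
                      (λ p → ∈-remove⁺ (⊆-cl (∈-insert-there p)) (λ { refl → f∉T p }))
                      (trans (suc-injective (trans size-T (sym size))) (Basis.size basis-F-f))
    exchange-Fₜ : exchange Fₜ ≡ G
    exchange-Fₜ = trans (basis⇒cl≡ (basis-insert basis-T (Basis.indep B)) B) G-flat

  cl-separating : f ∉ S → Indep (insert f S) → ∣ S ∣ ≡ k → g ∈ cl M S → Separating g f (cl M S)
  cl-separating f∉S indep-fS size g∈cl =
    (cl-isFlat _ , trans (rank-cl _) (trans (rank-indep (indep-⊆ ∈-insert-there indep-fS)) size) , g∈cl)
    , indep⇒∉cl indep-fS f∉S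

  circuit-exchange-preimage : Circuit M C → g ∈ C → x ∈ C → x ≢ g → C - g ⊆ S →
                              f ∉ S → Indep (insert f S) → ∣ S ∣ ≡ k →
    Separating f g (cl M (insert f (S - x))) × exchange (cl M (insert f (S - x))) ≡ cl M S
  circuit-exchange-preimage {C} {x} {S} circ g∈C x∈C x≢g C-g⊆S f∉S indep-fS size =
    exchange-preimage (cl-separating f∉S indep-fS size g∈cl) (λ p → g∉S (remove-⊆ p)) basis
    where
    indep-S : Indep S
    indep-S = indep-⊆ ∈-insert-there indep-fS
    x∈S : x ∈ S
    x∈S = C-g⊆S (∈-remove⁺ x∈C x≢g)
    g∈cl : g ∈ cl M S
    g∈cl = cl-mono C-g⊆S (circuit-spans circ g∈C)
    g∉S : g ∉ S
    g∉S g∈S = proj₁ circ (indep-⊆ (subst (λ X → X ⊆ S) (insert-remove g∈C) (insert-⊆ g∈S C-g⊆S)) indep-S)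
    basis : Basis (cl M S) (insert g (S - x))
    basis = mkBasis (circuit-exchange circ g∈C x∈C x≢g C-g⊆S indep-S)
                    (insert-⊆ g∈cl (λ p → ⊆-cl (remove-⊆ p)))
                    (begin
                      ∣ insert g (S - x) ∣   ≡⟨ ∣insert∣ (λ p → g∉S (remove-⊆ p)) ⟩
                      suc ∣ S - x ∣          ≡⟨ ∣remove∣ x∈S ⟨
                      ∣ S ∣                  ≡⟨ rank-indep indep-S ⟨
                      rank M S               ≡⟨ rank-cl S ⟨
                      rank M (cl M S)        ∎)
      where open ≡-Reasoning

  separating? : ∀ x y → Decidable (Separating x y)
  separating? x y = FlatOfRankContaining? M k x ∩? ∁? (y ∈?_)

  separatingFlats : Fin n → Fin n → List (Subset n)
  separatingFlats x y = filter (separating? x y) (allSubsets n)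

  #sep : Fin n → Fin n → ℕ
  #sep x y = length (separatingFlats x y)

  ∈separatingFlats⁺ : Separating x y F → F ∈ₗ separatingFlats x y
  ∈separatingFlats⁺ sep = ∈-filter⁺ (separating? _ _) (allSubsets-complete _) sep

  ∈separatingFlats⁻ : F ∈ₗ separatingFlats x y → Separating x y F
  ∈separatingFlats⁻ F∈ = proj₂ (∈-filter⁻ (separating? _ _) {xs = allSubsets n} F∈)

  separatingFlats-unique : Unique (separatingFlats x y)
  separatingFlats-unique = Unique.filter⁺ (separating? _ _) (allSubsets-unique n)

  W≡W⇔#sep≡#sep : W M k f ≡ W M k g ⇔ #sep f g ≡ #sep g f
  W≡W⇔#sep≡#sep = mk⇔
    (λ eq → +-cancelˡ-≡ (length (both g f)) _ _ (begin
      length (both g f) + #sep f g    ≡⟨ cong (λ Fs → length Fs + #sep f g) both-comm ⟨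
      length (both f g) + #sep f g    ≡⟨ split f g ⟨
      W M k f                         ≡⟨ eq ⟩
      W M k g                         ≡⟨ split g f ⟩
      length (both g f) + #sep g f    ∎))
    (λ eq → trans (split f g) (trans (cong₂ _+_ (cong length both-comm) eq) (sym (split g f))))
    where
    open ≡-Reasoning
    both : Fin n → Fin n → List (Subset n)
    both x y = filter (FlatOfRankContaining? M k x ∩? (y ∈?_)) (allSubsets n)
    split : ∀ x y → W M k x ≡ length (both x y) + #sep x y
    split x y = length-filter-∩ (FlatOfRankContaining? M k x) (y ∈?_) (allSubsets n)
    both-comm : both f g ≡ both g f
    both-comm = filter-≐ _ _ ((λ ((F-flat , rank-F , f∈F) , g∈F) → (F-flat , rank-F , g∈F) , f∈F)
                            , (λ ((F-flat , rank-F , g∈F) , f∈F) → (F-flat , rank-F , f∈F) , g∈F)) (allSubsets n)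

  loop⇒#sep≡0 : ¬ Indep ⁅ y ⁆ → #sep x y ≡ 0
  loop⇒#sep≡0 {y} {x} loop = cong length (filter-none (separating? x y) (All.universal not-separating (allSubsets n)))
    where
    not-separating : ∀ F → ¬ Separating x y F
    not-separating F ((F-flat , _) , y∉F) = y∉F (loop∈flat loop F-flat)

  module _ (g-nonloop : Indep ⁅ g ⁆) where

    private
      basisThrough-g : ∀ G → ∃[ J ] ⁅ g ⁆ ⊆ J × Basis (insert g G) J
      basisThrough-g G = extend-to-basis g-nonloop (⁅⁆-⊆ ∈-insert-here)

    unexchange : Subset n → Subset n
    unexchange G = cl M (insert f (proj₁ (basisThrough-g G) - g))

    unexchange-section : Separating g f G → Separating f g (unexchange G) × exchange (unexchange G) ≡ G
    unexchange-section {G} sep@((_ , _ , g∈G) , _) = exchange-preimage sep x∉X-x basis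
      where
      J : Subset n
      J = proj₁ (basisThrough-g G)
      g∈J : g ∈ J
      g∈J = proj₁ (proj₂ (basisThrough-g G)) (x∈⁅x⁆ g)
      basis : Basis G (insert g (J - g))
      basis = subst₂ Basis (insert-∈ g∈G) (sym (insert-remove g∈J)) (proj₂ (proj₂ (basisThrough-g G)))

    unexchange-into : G ∈ₗ separatingFlats g f → unexchange G ∈ₗ separatingFlats f g
    unexchange-into G∈ = ∈separatingFlats⁺ (proj₁ (unexchange-section (∈separatingFlats⁻ G∈)))

    unexchange-injectiveOn : G ∈ₗ separatingFlats g f → G′ ∈ₗ separatingFlats g f →
                             unexchange G ≡ unexchange G′ → G ≡ G′
    unexchange-injectiveOn {G} {G′} G∈ G′∈ eq = begin
      G                          ≡⟨ proj₂ (unexchange-section (∈separatingFlats⁻ G∈)) ⟨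
      exchange (unexchange G)    ≡⟨ cong exchange eq ⟩
      exchange (unexchange G′)   ≡⟨ proj₂ (unexchange-section (∈separatingFlats⁻ G′∈)) ⟩
      G′                         ∎
      where open ≡-Reasoning

    unexchange-hits : G ∈ₗ separatingFlats g f → unexchange G ≡ F → unexchange (exchange F) ≡ F
    unexchange-hits {G} {F} G∈ eq = subst (λ Z → unexchange Z ≡ F) G≡exchange-F eq
      where
      G≡exchange-F : G ≡ exchange F
      G≡exchange-F = trans (sym (proj₂ (unexchange-section (∈separatingFlats⁻ G∈)))) (cong exchange eq)

    #sep-gf≤#sep-fg : #sep g f ≤ #sep f g
    #sep-gf≤#sep-fg = length-≤-injectiveOn unexchange separatingFlats-unique unexchange-into unexchange-injectiveOn

    -- By unexchange-hits, unexchange cannot hit both F₁ and F₂.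
    two-preimages⇒#sep-gf<#sep-fg : Separating f g F₁ → Separating f g F₂ → F₁ ≢ F₂ →
                                    exchange F₁ ≡ exchange F₂ → #sep g f < #sep f g
    two-preimages⇒#sep-gf<#sep-fg {F₁} {F₂} sep₁ sep₂ F₁≢F₂ same-exchange =
      by-cases (unexchange (exchange F₁) ≟ˢ F₁)
      where
      missing : ∀ {F} → Separating f g F → (∀ {G} → G ∈ₗ separatingFlats g f → unexchange G ≢ F) → #sep g f < #sep f g
      missing sep = length-<-injectiveOn unexchange separatingFlats-unique unexchange-into unexchange-injectiveOn
                                         (∈separatingFlats⁺ sep)
      by-cases : Dec (unexchange (exchange F₁) ≡ F₁) → #sep g f < #sep f g
      by-cases (yes hit₁) = missing sep₂
        (λ G∈ eq → F₁≢F₂ (trans (sym hit₁) (trans (cong unexchange same-exchange) (unexchange-hits G∈ eq))))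
      by-cases (no miss₁) = missing sep₁ (λ G∈ eq → miss₁ (unexchange-hits G∈ eq))

module Truncation (M : Matroid n) {f g : Fin n} (2≤rk : 2 ≤ rk M) (f≢g : f ≢ g) (freer : Freer M f g) where
  open Matroid M
  open MatroidProperties M

  k : ℕ
  k = rk M ∸ 2

  open Exchange M f≢g freer k

  private variable
    C F F₁ F₂ : Subset n

  rk≡2+k : rk M ≡ 2 + k
  rk≡2+k = trans (sym (m∸n+n≡m 2≤rk)) (+-comm k 2)

  rk∸1≡1+k : rk M ∸ 1 ≡ suc k
  rk∸1≡1+k = cong (_∸ 1) rk≡2+k

  N : Fin n → Set
  N = NGround M f g

  N-f : N f
  N-f = ∈⊤ , λ (f≢f , _) → f≢f refl

  N-g : N g
  N-g = ∈⊤ , λ (_ , g≢g , _) → g≢g refl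

  insert-N : N x → SubsetOfGround N Y → SubsetOfGround N (insert x Y)
  insert-N Nx Y⊆N z z∈ = [ (λ { refl → Nx }) , Y⊆N z ] (∈-insert⁻ z∈)

  -- The converse implication always holds, by freeness: see clones⇔Exchangeable.
  Exchangeable : Set
  Exchangeable = ∀ {Y} → SubsetOfGround N Y → f ∉ Y → g ∉ Y → τIndep M (insert f Y) → τIndep M (insert g Y)

  clones⇔Exchangeable : ClonesIn N (NIndep M f g) f g ⇔ Exchangeable
  clones⇔Exchangeable = ⇔.trans (clones⇔interchangeable N (NIndep M f g) f≢g N-f N-g) (mk⇔ forward backward)
    where
    forward : Interchangeable N (NIndep M f g) f g → Exchangeable
    forward interchange Y⊆N f∉Y g∉Y τ-indep =
      proj₂ (Equivalence.to (interchange Y⊆N f∉Y g∉Y) (insert-N N-f Y⊆N , τ-indep))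
    backward : Exchangeable → Interchangeable N (NIndep M f g) f g
    backward exchangeable {Y} Y⊆N f∉Y g∉Y = mk⇔
      (λ (_ , τ-indep) → insert-N N-g Y⊆N , exchangeable Y⊆N f∉Y g∉Y τ-indep)
      (λ (_ , indep-gY , size) → insert-N N-f Y⊆N
        , decidable-stable (Indep? _)
            (λ dep → freer⇒dependent freer (indep-⊆ ∈-insert-there indep-gY) g∉Y dep indep-gY)
        , subst (_≤ _) (trans (∣insert∣ g∉Y) (sym (∣insert∣ f∉Y))) size)

  deletable∉flat : 1 ≤ k → IsFlat M F → g ∉ F → toDelete M f g x → x ∉ F
  deletable∉flat 1≤k F-flat g∉F (_ , _ , parallel) x∈F =
    g∉F (flat-closed F-flat (cl-mono (⁅⁆-⊆ x∈F) (τ-parallel⇒∈cl 2≤rk∸1 parallel)))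
    where
    2≤rk∸1 : 2 ≤ rk M ∸ 1
    2≤rk∸1 = subst (2 ≤_) (sym rk∸1≡1+k) (s≤s 1≤k)

  separating⇒⊆N : 1 ≤ k → Separating f g F → SubsetOfGround N F
  separating⇒⊆N 1≤k ((F-flat , _) , g∉F) x x∈F = ∈⊤ , λ deletable → deletable∉flat 1≤k F-flat g∉F deletable x∈F

  exchange≡⇒⊆ : Exchangeable → Separating f g F₁ → Separating f g F₂ → exchange F₁ ≡ exchange F₂ → F₁ ⊆ F₂
  exchange≡⇒⊆ {F₁} {F₂} exchangeable sep₁@(_ , g∉F₁) sep₂@((F₂-flat , _ , f∈F₂) , _) same-exchange {y} y∈F₁
    with y ∈? F₂
  ... | yes y∈F₂ = y∈F₂
  ... | no y∉F₂ = contradiction (exchangeable Y⊆N f∉Y g∉Y (indep-⊆ insert-comm indep-yfJ , size≤))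
                                (λ τ-indep → dependent-ygJ (indep-⊆ insert-comm (proj₁ τ-indep)))
    where
    open ExchangeBasis (exchangeBasis sep₂)
    J⊆F₂ : J ⊆ F₂
    J⊆F₂ p = remove-⊆ (Basis.⊆-set basis-F-f p)
    y∉J : y ∉ J
    y∉J p = y∉F₂ (J⊆F₂ p)
    y≢f : y ≢ f
    y≢f refl = y∉F₂ f∈F₂
    y≢g : y ≢ g
    y≢g refl = g∉F₁ y∈F₁
    f∉Y : f ∉ insert y J
    f∉Y p = [ y≢f ∘ sym , f∉J ] (∈-insert⁻ p)
    g∉Y : g ∉ insert y J
    g∉Y p = [ y≢g ∘ sym , g∉J ] (∈-insert⁻ p)
    1≤k : 1 ≤ k
    1≤k = subst (1 ≤_) size (s≤s z≤n)
    Y⊆N : SubsetOfGround N (insert y J)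
    Y⊆N z z∈ = [ (λ { refl → separating⇒⊆N 1≤k sep₁ z y∈F₁ }) , (λ z∈J → separating⇒⊆N 1≤k sep₂ z (J⊆F₂ z∈J)) ]
                (∈-insert⁻ z∈)
    indep-yfJ : Indep (insert y (insert f J))
    indep-yfJ = decidable-stable (Indep? _) (λ dep → y∉F₂ (flat-closed F₂-flat (spans⇒∈cl basis-F (inj₂ dep))))
    dependent-ygJ : ¬ Indep (insert y (insert g J))
    dependent-ygJ = spans⇒dependent
      (∈cl⇒spans basis-exchange (subst (y ∈_) same-exchange (⊆-cl (∈-insert-there (∈-remove⁺ y∈F₁ y≢f)))))
      (λ p → [ y≢g , y∉J ] (∈-insert⁻ p))
    size≤ : ∣ insert f (insert y J) ∣ ≤ rk M ∸ 1
    size≤ = ≤-reflexive (trans (∣insert∣ f∉Y) (trans (cong suc (trans (∣insert∣ y∉J) size)) (sym rk∸1≡1+k)))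

  #sep-fg≤#sep-gf : Exchangeable → #sep f g ≤ #sep g f
  #sep-fg≤#sep-gf exchangeable = length-≤-injectiveOn exchange separatingFlats-unique
    (λ F∈ → ∈separatingFlats⁺ (exchange-separating (∈separatingFlats⁻ F∈)))
    (λ F∈ F′∈ eq → ⊆-antisym (exchange≡⇒⊆ exchangeable (∈separatingFlats⁻ F∈) (∈separatingFlats⁻ F′∈) eq)
                             (exchange≡⇒⊆ exchangeable (∈separatingFlats⁻ F′∈) (∈separatingFlats⁻ F∈) (sym eq)))

  extend-with-f : Indep (insert f Y) → f ∉ Y → ∣ insert f Y ∣ ≤ suc k →
                  ∃[ S ] Y ⊆ S × f ∉ S × Indep (insert f S) × ∣ S ∣ ≡ k
  extend-with-f {Y} indep-fY f∉Y size≤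
    with extend-to-size (suc k) indep-fY (λ _ → ∈⊤) size≤ (subst (suc k ≤_) (sym rk≡2+k) (n≤1+n (suc k)))
  ... | T , fY⊆T , _ , indep-T , size-T =
    T - f , (λ p → ∈-remove⁺ (fY⊆T (∈-insert-there p)) (λ { refl → f∉Y p })) , x∉X-x
    , subst Indep (sym (insert-remove f∈T)) indep-T , suc-injective (trans (sym (∣remove∣ f∈T)) size-T)
    where
    f∈T : f ∈ T
    f∈T = fY⊆T ∈-insert-here

  module _ (g-nonloop : Indep ⁅ g ⁆) where

    -- If C were {a, g}, then a would be parallel to g in τ(M), so not in N.
    circuit-has-two-others : Circuit M C → g ∈ C → C - g ⊆ Y → SubsetOfGround N Y → f ∉ Y →
                             ∃[ a ] ∃[ b ] a ∈ C - g × b ∈ C - g × a ≢ b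
    circuit-has-two-others {C} circ g∈C C-g⊆Y Y⊆N f∉Y with ⊆-or-witness C ⁅ g ⁆
    ... | inj₁ C⊆⁅g⁆ = contradiction (indep-⊆ C⊆⁅g⁆ g-nonloop) (proj₁ circ)
    ... | inj₂ (a , a∈C , a∉⁅g⁆) with ⊆-or-witness C (insert a ⁅ g ⁆)
    ...   | inj₂ (b , b∈C , b∉) = b , a , ∈-remove⁺ b∈C (λ { refl → b∉ (∈-insert-there (x∈⁅x⁆ g)) }) , a∈C-g
                                , λ { refl → b∉ ∈-insert-here }
      where
      a∈C-g : a ∈ C - g
      a∈C-g = ∈-remove⁺ a∈C (λ { refl → a∉⁅g⁆ (x∈⁅x⁆ g) })
    ...   | inj₁ C⊆⁅a,g⁆ = contradiction a-deletable (proj₂ (Y⊆N a (C-g⊆Y a∈C-g)))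
      where
      a≢g : a ≢ g
      a≢g refl = a∉⁅g⁆ (x∈⁅x⁆ g)
      a∈C-g : a ∈ C - g
      a∈C-g = ∈-remove⁺ a∈C a≢g
      C≡⁅a,g⁆ : C ≡ insert a ⁅ g ⁆
      C≡⁅a,g⁆ = ⊆-antisym C⊆⁅a,g⁆ (insert-⊆ a∈C (⁅⁆-⊆ g∈C))
      a-deletable : toDelete M f g a
      a-deletable = (λ { refl → f∉Y (C-g⊆Y a∈C-g) }) , a≢g , a≢g
                  , circuit⇒τ-circuit (subst (Circuit M) C≡⁅a,g⁆ circ) (subst (_≤ rk M) (sym (∣pair∣ a≢g)) 2≤rk)

    circuit⇒#sep-gf<#sep-fg : Circuit M C → g ∈ C → (∃[ a ] ∃[ b ] a ∈ C - g × b ∈ C - g × a ≢ b) →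
                              (∃[ S ] C - g ⊆ S × f ∉ S × Indep (insert f S) × ∣ S ∣ ≡ k) → #sep g f < #sep f g
    circuit⇒#sep-gf<#sep-fg {C} circ g∈C (a , b , a∈C-g , b∈C-g , a≢b) (S , C-g⊆S , f∉S , indep-fS , size-S) =
      two-preimages⇒#sep-gf<#sep-fg g-nonloop (proj₁ (preimage a∈C-g)) (proj₁ (preimage b∈C-g))
        (λ eq → avoids a∈C-g (subst (a ∈_) (sym eq) a∈Fb))
        (trans (proj₂ (preimage a∈C-g)) (sym (proj₂ (preimage b∈C-g))))
      where
      preimage : x ∈ C - g → Separating f g (cl M (insert f (S - x))) × exchange (cl M (insert f (S - x))) ≡ cl M S
      preimage x∈C-g =
        circuit-exchange-preimage circ g∈C (remove-⊆ x∈C-g) (∈-remove⁻ x∈C-g) C-g⊆S f∉S indep-fS size-S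
      avoids : x ∈ C - g → x ∉ cl M (insert f (S - x))
      avoids x∈C-g = indep⇒∉cl-remove indep-fS f∉S (C-g⊆S x∈C-g)
      a∈Fb : a ∈ cl M (insert f (S - b))
      a∈Fb = ⊆-cl (∈-insert-there (∈-remove⁺ (C-g⊆S a∈C-g) a≢b))

    exchange-failure⇒#sep-gf<#sep-fg : SubsetOfGround N Y → f ∉ Y → Indep (insert f Y) → ∣ insert f Y ∣ ≤ suc k →
                                       ¬ Indep (insert g Y) → #sep g f < #sep f g
    exchange-failure⇒#sep-gf<#sep-fg {Y} Y⊆N f∉Y indep-fY size≤ dependent =
      from-circuit (circuit-through (indep-⊆ ∈-insert-there indep-fY) dependent)
      where
      from-circuit : ∃[ C ] C ⊆ insert g Y × Circuit M C × g ∈ C → #sep g f < #sep f g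
      from-circuit (C , C⊆gY , circ , g∈C) =
        circuit⇒#sep-gf<#sep-fg circ g∈C (circuit-has-two-others circ g∈C C-g⊆Y Y⊆N f∉Y)
          (extend-with-f (indep-⊆ (insert-mono C-g⊆Y) indep-fY) (λ p → f∉Y (C-g⊆Y p))
                         (≤-trans (p⊆q⇒∣p∣≤∣q∣ (insert-mono {x = f} C-g⊆Y)) size≤))
        where
        C-g⊆Y : C - g ⊆ Y
        C-g⊆Y = ⊆insert⇒remove⊆ C⊆gY

  loop⇒#sep-gf≢0 : ¬ Indep ⁅ g ⁆ → Indep (insert f Y) → f ∉ Y → ∣ insert f Y ∣ ≤ suc k → #sep g f ≢ 0
  loop⇒#sep-gf≢0 g-loop indep-fY f∉Y size≤ = from-extension (extend-with-f indep-fY f∉Y size≤)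
    where
    from-extension : ∃[ S ] _ ⊆ S × f ∉ S × Indep (insert f S) × ∣ S ∣ ≡ k → #sep g f ≢ 0
    from-extension (S , _ , f∉S , indep-fS , size-S) eq =
      <-irrefl (sym eq) (filter-some (separating? g f) (Any.map (λ { refl → sep-S }) (allSubsets-complete (cl M S))))
      where
      sep-S : Separating g f (cl M S)
      sep-S = cl-separating f∉S indep-fS size-S (loop∈flat g-loop (cl-isFlat S))

  exchange-failure⇒#sep≢ : SubsetOfGround N Y → f ∉ Y → τIndep M (insert f Y) → ¬ Indep (insert g Y) →
                            #sep f g ≢ #sep g f
  exchange-failure⇒#sep≢ {Y} Y⊆N f∉Y (indep-fY , size≤) dependent = by-cases (Indep? ⁅ g ⁆)
    where
    size≤′ : ∣ insert f Y ∣ ≤ suc k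
    size≤′ = subst (∣ insert f Y ∣ ≤_) rk∸1≡1+k size≤
    by-cases : Dec (Indep ⁅ g ⁆) → #sep f g ≢ #sep g f
    by-cases (yes g-nonloop) eq =
      <-irrefl (sym eq) (exchange-failure⇒#sep-gf<#sep-fg g-nonloop Y⊆N f∉Y indep-fY size≤′ dependent)
    by-cases (no g-loop) eq = loop⇒#sep-gf≢0 g-loop indep-fY f∉Y size≤′ (trans (sym eq) (loop⇒#sep≡0 g-loop))

  exchangeable⇒loop⇒loop : Exchangeable → ¬ Indep ⁅ g ⁆ → ¬ Indep ⁅ f ⁆
  exchangeable⇒loop⇒loop exchangeable g-loop f-nonloop =
    g-loop (indep-⊆ (⁅⁆-⊆ ∈-insert-here) (proj₁ (exchangeable ⊥⊆N ∉⊥ ∉⊥ (indep-f , size-f))))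
    where
    ⊥⊆N : SubsetOfGround N ⊥
    ⊥⊆N _ p = contradiction p ∉⊥
    indep-f : Indep (insert f ⊥)
    indep-f = indep-⊆ (insert-⊆ (x∈⁅x⁆ f) ⊥⊆) f-nonloop
    size-f : ∣ insert f ⊥ ∣ ≤ rk M ∸ 1
    size-f = subst₂ _≤_ (sym (trans (∣insert∣ {x = f} {⊥} ∉⊥) (cong suc (∣⊥∣≡0 n)))) (sym rk∸1≡1+k)
                    (s≤s z≤n)

  #sep≡#sep⇔Exchangeable : #sep f g ≡ #sep g f ⇔ Exchangeable
  #sep≡#sep⇔Exchangeable = mk⇔ equal⇒exchangeable exchangeable⇒equal
    where
    equal⇒exchangeable : #sep f g ≡ #sep g f → Exchangeable
    equal⇒exchangeable eq {Y} Y⊆N f∉Y g∉Y τ-indep@(_ , size≤) =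
      decidable-stable (Indep? (insert g Y)) (λ dependent → exchange-failure⇒#sep≢ Y⊆N f∉Y τ-indep dependent eq)
      , subst (_≤ _) (trans (∣insert∣ f∉Y) (sym (∣insert∣ g∉Y))) size≤
    exchangeable⇒equal : Exchangeable → #sep f g ≡ #sep g f
    exchangeable⇒equal exchangeable = by-cases (Indep? ⁅ g ⁆)
      where
      by-cases : Dec (Indep ⁅ g ⁆) → #sep f g ≡ #sep g f
      by-cases (yes g-nonloop) = ≤-antisym (#sep-fg≤#sep-gf exchangeable) (#sep-gf≤#sep-fg g-nonloop)
      by-cases (no g-loop) =
        trans (loop⇒#sep≡0 g-loop) (sym (loop⇒#sep≡0 (exchangeable⇒loop⇒loop exchangeable g-loop)))

corollary14 : ∀ {n} (M : Matroid n) (f g : Fin n) →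
    2 ≤ rk M → f ≢ g → Freer M f g →
    (W M (rk M ∸ 2) f ≡ W M (rk M ∸ 2) g ⇔ ClonesIn (NGround M f g) (NIndep M f g) f g)
corollary14 M f g 2≤rk f≢g freer =
  ⇔.trans W≡W⇔#sep≡#sep (⇔.trans #sep≡#sep⇔Exchangeable (⇔.sym clones⇔Exchangeable))
  where
  open Truncation M 2≤rk f≢g freer
  open Exchange M f≢g freer k
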